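{- Let $(\mathbb{L},\Box,\Diamond)$ be an $\mathcal{L}$-algebra. For every proper $\mathbf{A}$-filter $f$ and every proper $\mathbf{A}$-ideal $i$ of $\mathbb{L}$: (1) $\bigvee_{b\in\mathbb{L}}(f^{ -\Diamond}(b)\otimes i(b))=\bigvee_{a\in\mathbb{L}}(f(a)\otimes i(\Diamond a))$; (2) $\bigvee_{b\in\mathbb{L}}(f(b)\otimes i^{ -\Box}(b))=\bigvee_{a\in\mathbb{L}}(f(\Box a)\otimes i(a))$.
   Context: $\mathbf{A}=(D,1,0,\vee,\wedge,\otimes,\to)$ is a complete, commutative, associative residuated lattice which is frame-distributive and dually frame-distributive, with $1\to\alpha=\alpha$ for all $\alpha$. An $\mathcal{L}$-algebra is a bounded lattice $\mathbb{L}$ with monotone unary operations $\Box$ preserving finite meets and $\Diamond$ preserving finite joins. An $\mathbf{A}$-filter of $\mathbb{L}$ is a map $f:\mathbb{L}\to\mathbf{A}$ with $f(\top)=1$ and $f(a\wedge b)=f(a)\wedge f(b)$; proper if also $f(\bot)=0$. An $\mathbf{A}$-ideal is a map $i:\mathbb{L}\to\mathbf{A}$ with $i(\bot)=1$ and $i(a\vee b)=i(a)\wedge i(b)$; proper if also $i(\top)=0$. For $k:\mathbb{L}\to\mathbf{A}$, $k^{ -\Diamond}(a):=\bigvee\{k(b)\mid\Diamond b\le a\}$ and $k^{ -\Box}(a):=\bigvee\{k(b)\mid a\le\Box b\}$. -}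

module Defs where

open import Level using (Level; _⊔_; suc)
open import Data.Product using (Σ; _×_; _,_)
open import Relation.Binary.Lattice.Bundles using (BoundedLattice)

record CRL (c ℓ₁ ℓ₂ ι : Level) : Set (suc (c ⊔ ℓ₁ ⊔ ℓ₂ ⊔ ι)) where
  infixr 7 _⊗_
  infixr 5 _⇒_
  field
    boundedLattice : BoundedLattice c ℓ₁ ℓ₂
  open BoundedLattice boundedLattice public hiding (lattice)
    renaming (⊤ to 𝟙; ⊥ to 𝟘)
  field
    ⋁         : {I : Set ι} → (I → Carrier) → Carrier
    ⋁-upper   : {I : Set ι} (g : I → Carrier) (j : I) → g j ≤ ⋁ g
    ⋁-least   : {I : Set ι} (g : I → Carrier) (x : Carrier) →
                ((j : I) → g j ≤ x) → ⋁ g ≤ x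
    ⋀         : {I : Set ι} → (I → Carrier) → Carrier
    ⋀-lower   : {I : Set ι} (g : I → Carrier) (j : I) → ⋀ g ≤ g j
    ⋀-greatest : {I : Set ι} (g : I → Carrier) (x : Carrier) →
                ((j : I) → x ≤ g j) → x ≤ ⋀ g
    _⊗_       : Carrier → Carrier → Carrier
    _⇒_       : Carrier → Carrier → Carrier
    ⊗-comm    : (x y : Carrier) → (x ⊗ y) ≈ (y ⊗ x)
    ⊗-assoc   : (x y z : Carrier) → ((x ⊗ y) ⊗ z) ≈ (x ⊗ (y ⊗ z))
    residuation→ : (x y z : Carrier) → (x ⊗ y) ≤ z → y ≤ (x ⇒ z)
    residuation← : (x y z : Carrier) → y ≤ (x ⇒ z) → (x ⊗ y) ≤ z
    𝟙⇒        : (x : Carrier) → (𝟙 ⇒ x) ≈ x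
    frame-distrib : (x : Carrier) {I : Set ι} (g : I → Carrier) →
                    (x ∧ ⋁ g) ≈ ⋁ (λ j → x ∧ g j)
    dual-frame-distrib : (x : Carrier) {I : Set ι} (g : I → Carrier) →
                    (x ∨ ⋀ g) ≈ ⋀ (λ j → x ∨ g j)

record LAlgebra (c ℓ₁ ℓ₂ : Level) : Set (suc (c ⊔ ℓ₁ ⊔ ℓ₂)) where
  field
    boundedLattice : BoundedLattice c ℓ₁ ℓ₂
  open BoundedLattice boundedLattice public hiding (lattice)
  field
    □ : Carrier → Carrier
    ◇ : Carrier → Carrier
    □-mono : {a b : Carrier} → a ≤ b → □ a ≤ □ b
    ◇-mono : {a b : Carrier} → a ≤ b → ◇ a ≤ ◇ b
    □-⊤    : □ ⊤ ≈ ⊤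
    □-∧    : (a b : Carrier) → □ (a ∧ b) ≈ (□ a ∧ □ b)
    ◇-⊥    : ◇ ⊥ ≈ ⊥
    ◇-∨    : (a b : Carrier) → ◇ (a ∨ b) ≈ (◇ a ∨ ◇ b)

module _ {c ℓ₁ ℓ₂ c' ℓ₁' ℓ₂' : Level}
         (𝔸 : CRL c' ℓ₁' ℓ₂' (c ⊔ ℓ₂)) (𝕃 : LAlgebra c ℓ₁ ℓ₂) where
  private
    module A = CRL 𝔸
    module L = LAlgebra 𝕃

  -- maps respect the equality of 𝕃 (setoid reading of "map 𝕃 → A")
  Respects : (L.Carrier → A.Carrier) → Set (c ⊔ ℓ₁ ⊔ ℓ₁')
  Respects k = (a b : L.Carrier) → a L.≈ b → k a A.≈ k b

  IsFilter : (L.Carrier → A.Carrier) → Set (c ⊔ ℓ₁ ⊔ ℓ₁')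
  IsFilter f = Respects f × (f L.⊤ A.≈ A.𝟙)
             × ((a b : L.Carrier) → f (a L.∧ b) A.≈ (f a A.∧ f b))

  IsProperFilter : (L.Carrier → A.Carrier) → Set (c ⊔ ℓ₁ ⊔ ℓ₁')
  IsProperFilter f = IsFilter f × (f L.⊥ A.≈ A.𝟘)

  IsIdeal : (L.Carrier → A.Carrier) → Set (c ⊔ ℓ₁ ⊔ ℓ₁')
  IsIdeal i = Respects i × (i L.⊥ A.≈ A.𝟙)
            × ((a b : L.Carrier) → i (a L.∨ b) A.≈ (i a A.∧ i b))

  IsProperIdeal : (L.Carrier → A.Carrier) → Set (c ⊔ ℓ₁ ⊔ ℓ₁')
  IsProperIdeal i = IsIdeal i × (i L.⊤ A.≈ A.𝟘)

  _⁻◇ : (L.Carrier → A.Carrier) → L.Carrier → A.Carrier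
  (k ⁻◇) a = A.⋁ {Σ L.Carrier (λ b → L.◇ b L.≤ a)} (λ { (b , _) → k b })

  _⁻□ : (L.Carrier → A.Carrier) → L.Carrier → A.Carrier
  (k ⁻□) a = A.⋁ {Σ L.Carrier (λ b → a L.≤ L.□ b)} (λ { (b , _) → k b })

  ⋁𝕃 : (L.Carrier → A.Carrier) → A.Carrier
  ⋁𝕃 g = A.⋁ {Level.Lift ℓ₂ L.Carrier} (λ x → g (Level.lower x))

module Submission where

-- Both equalities are proved by comparing the two joins termwise.
-- First, general facts about complete residuated lattices: ⊗ is monotone
-- and distributes over ⋁ (residuation makes x ⊗ _ a left adjoint), and a
-- join is below another one as soon as each of its terms is dominated by
-- some term of the other.  Second, filters are monotone and ideals
-- antitone, and k(b) ≤ k^{-◇}(◇b), k(b) ≤ k^{-□}(□b).  Equality (1)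
-- then holds for any k in place of f and any antitone i, and (2) for any
-- monotone f and any k in place of i.

open import Defs
open import Level using (Level; _⊔_; lift)
open import Data.Product using (Σ; _×_; _,_; proj₁)
import Relation.Binary.Lattice.Properties.JoinSemilattice as JoinProperties
import Relation.Binary.Lattice.Properties.MeetSemilattice as MeetProperties
import Relation.Binary.Reasoning.PartialOrder as ≤-Reasoning

module ResiduatedLattice {c ℓ₁ ℓ₂ ι : Level} (𝔸 : CRL c ℓ₁ ℓ₂ ι) where
  open CRL 𝔸

  -- x ⊗ _ is monotone: x ⊗ y ≤ x ⊗ y' is the residual form of y ≤ x ⇒ (x ⊗ y').
  ⊗-monoʳ : (x : Carrier) {y y' : Carrier} → y ≤ y' → (x ⊗ y) ≤ (x ⊗ y')
  ⊗-monoʳ x {y} {y'} y≤y' =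
    residuation← x y (x ⊗ y') (trans y≤y' (residuation→ x y' (x ⊗ y') refl))

  ⊗-monoˡ : {x x' : Carrier} (y : Carrier) → x ≤ x' → (x ⊗ y) ≤ (x' ⊗ y)
  ⊗-monoˡ {x} {x'} y x≤x' =
    trans (reflexive (⊗-comm x y))
          (trans (⊗-monoʳ y x≤x') (reflexive (⊗-comm y x')))

  ⋁-dominated : {I J : Set ι} (g : I → Carrier) (h : J → Carrier) →
                ((j : I) → Σ J (λ k → g j ≤ h k)) → ⋁ g ≤ ⋁ h
  ⋁-dominated g h dom = ⋁-least g (⋁ h) λ j →
    let (k , gj≤hk) = dom j in trans gj≤hk (⋁-upper h k)

  -- x ⊗ _ preserves joins: each x ⊗ g j ≤ ⋁ (x ⊗ g), so every g j lies
  -- below x ⇒ ⋁ (x ⊗ g), hence so does ⋁ g.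
  ⊗-distribˡ-⋁ : (x : Carrier) {I : Set ι} (g : I → Carrier) →
                 (x ⊗ ⋁ g) ≤ ⋁ (λ j → x ⊗ g j)
  ⊗-distribˡ-⋁ x g = residuation← x (⋁ g) _ (⋁-least g _ λ j →
    residuation→ x (g j) _ (⋁-upper (λ j → x ⊗ g j) j))

  ⊗-distribʳ-⋁ : (y : Carrier) {I : Set ι} (g : I → Carrier) →
                 (⋁ g ⊗ y) ≤ ⋁ (λ j → g j ⊗ y)
  ⊗-distribʳ-⋁ y g =
    trans (reflexive (⊗-comm (⋁ g) y))
          (trans (⊗-distribˡ-⋁ y g)
                 (⋁-dominated _ _ λ j → j , reflexive (⊗-comm y (g j))))

module Transfer {c ℓ₁ ℓ₂ c' ℓ₁' ℓ₂' : Level}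
    (𝔸 : CRL c' ℓ₁' ℓ₂' (c ⊔ ℓ₂)) (𝕃 : LAlgebra c ℓ₁ ℓ₂) where
  private
    module A = CRL 𝔸
    module L = LAlgebra 𝕃
  open ResiduatedLattice 𝔸

  filter-mono : {f : L.Carrier → A.Carrier} → IsFilter 𝔸 𝕃 f →
                {a b : L.Carrier} → a L.≤ b → f a A.≤ f b
  filter-mono {f} (f-resp , _ , f-∧) {a} {b} a≤b = begin
    f a           ≈⟨ f-resp _ _ (L.Eq.sym (y≤x⇒x∧y≈y a≤b)) ⟩
    f (b L.∧ a)   ≈⟨ f-∧ b a ⟩
    f b A.∧ f a   ≤⟨ proj₁ (A.infimum (f b) (f a)) ⟩
    f b           ∎
    where
      open MeetProperties L.meetSemilattice using (y≤x⇒x∧y≈y)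
      open ≤-Reasoning A.poset

  ideal-anti : {i : L.Carrier → A.Carrier} → IsIdeal 𝔸 𝕃 i →
               {a b : L.Carrier} → a L.≤ b → i b A.≤ i a
  ideal-anti {i} (i-resp , _ , i-∨) {a} {b} a≤b = begin
    i b           ≈⟨ i-resp _ _ (L.Eq.sym (x≤y⇒x∨y≈y a≤b)) ⟩
    i (a L.∨ b)   ≈⟨ i-∨ a b ⟩
    i a A.∧ i b   ≤⟨ proj₁ (A.infimum (i a) (i b)) ⟩
    i a           ∎
    where
      open JoinProperties L.joinSemilattice using (x≤y⇒x∨y≈y)
      open ≤-Reasoning A.poset

  ⁻◇-unit : (k : L.Carrier → A.Carrier) (b : L.Carrier) → k b A.≤ (_⁻◇ 𝔸 𝕃 k) (L.◇ b)
  ⁻◇-unit k b = A.⋁-upper {Σ L.Carrier (λ c → L.◇ c L.≤ L.◇ b)} (λ (c , _) → k c) (b , L.refl)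

  ⁻□-unit : (k : L.Carrier → A.Carrier) (b : L.Carrier) → k b A.≤ (_⁻□ 𝔸 𝕃 k) (L.□ b)
  ⁻□-unit k b = A.⋁-upper {Σ L.Carrier (λ c → L.□ b L.≤ L.□ c)} (λ (c , _) → k c) (b , L.refl)

  -- Part (1) for any k and any antitone j.  "≤": k^{-◇}(b) ⊗ j(b) is a join of
  -- terms k(c) ⊗ j(b) with ◇c ≤ b, each below k(c) ⊗ j(◇c).  "≥": the term
  -- k(a) ⊗ j(◇a) is below k^{-◇}(◇a) ⊗ j(◇a).
  ⁻◇-transfer : (k j : L.Carrier → A.Carrier) →
                ({a b : L.Carrier} → a L.≤ b → j b A.≤ j a) →
                ⋁𝕃 𝔸 𝕃 (λ b → (_⁻◇ 𝔸 𝕃 k) b A.⊗ j b) A.≈ ⋁𝕃 𝔸 𝕃 (λ a → k a A.⊗ j (L.◇ a))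
  ⁻◇-transfer k j j-anti = A.antisym
    (A.⋁-least _ _ λ (lift b) →
      A.trans (⊗-distribʳ-⋁ (j b) _)
              (⋁-dominated _ _ λ (c , ◇c≤b) → lift c , ⊗-monoʳ (k c) (j-anti ◇c≤b)))
    (⋁-dominated _ _ λ (lift a) → lift (L.◇ a) , ⊗-monoˡ (j (L.◇ a)) (⁻◇-unit k a))

  -- Part (2) for any monotone g and any k, dually: g(b) ⊗ k^{-□}(b) is a join
  -- of terms g(b) ⊗ k(c) with b ≤ □c, each below g(□c) ⊗ k(c).
  ⁻□-transfer : (g k : L.Carrier → A.Carrier) →
                ({a b : L.Carrier} → a L.≤ b → g a A.≤ g b) →
                ⋁𝕃 𝔸 𝕃 (λ b → g b A.⊗ (_⁻□ 𝔸 𝕃 k) b) A.≈ ⋁𝕃 𝔸 𝕃 (λ a → g (L.□ a) A.⊗ k a)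
  ⁻□-transfer g k g-mono = A.antisym
    (A.⋁-least _ _ λ (lift b) →
      A.trans (⊗-distribˡ-⋁ (g b) _)
              (⋁-dominated _ _ λ (c , b≤□c) → lift c , ⊗-monoˡ (k c) (g-mono b≤□c)))
    (⋁-dominated _ _ λ (lift a) → lift (L.□ a) , ⊗-monoʳ (g (L.□ a)) (⁻□-unit k a))

lemmaA2 : {c ℓ₁ ℓ₂ c' ℓ₁' ℓ₂' : Level}
          (𝔸 : CRL c' ℓ₁' ℓ₂' (c ⊔ ℓ₂)) (𝕃 : LAlgebra c ℓ₁ ℓ₂)
          (f i : LAlgebra.Carrier 𝕃 → CRL.Carrier 𝔸) →
          IsProperFilter 𝔸 𝕃 f → IsProperIdeal 𝔸 𝕃 i →
          (CRL._≈_ 𝔸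
            (⋁𝕃 𝔸 𝕃 (λ b → CRL._⊗_ 𝔸 (_⁻◇ 𝔸 𝕃 f b) (i b)))
            (⋁𝕃 𝔸 𝕃 (λ a → CRL._⊗_ 𝔸 (f a) (i (LAlgebra.◇ 𝕃 a)))))
          ×
          (CRL._≈_ 𝔸
            (⋁𝕃 𝔸 𝕃 (λ b → CRL._⊗_ 𝔸 (f b) (_⁻□ 𝔸 𝕃 i b)))
            (⋁𝕃 𝔸 𝕃 (λ a → CRL._⊗_ 𝔸 (f (LAlgebra.□ 𝕃 a)) (i a))))
lemmaA2 𝔸 𝕃 f i (f-filter , _) (i-ideal , _) =
    ⁻◇-transfer f i (ideal-anti i-ideal)
  , ⁻□-transfer f i (filter-mono f-filter)
  where open Transfer 𝔸 𝕃
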